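{- Let $\ell\ge 3$ be an odd integer and let $c$ be the edge-coloring of the complete graph $K_{\ell+1}$ on vertex set $\{0,1,\dots,\ell\}$ defined, for $0\le i<j\le \ell$, by $c(i,j)=2i \bmod \ell$ if $j=\ell$, and $c(i,j)=i+j\bmod \ell$ if $j<\ell$. Let $S\subseteq\{0,1,\dots,\ell\}$ be rainbow in $c$. If $\ell\in S$, then $S\setminus\{\ell\}$ is a $2$-Sidon set in $\mathbb{Z}_\ell$; otherwise $S$ is a weak $2$-Sidon set in $\mathbb{Z}_\ell$ (identifying $\{0,\dots,\ell-1\}$ with $\mathbb{Z}_\ell$).
   Context: A vertex set $S$ is rainbow if all edges with both endpoints in $S$ receive distinct colors. For an abelian group $G$ and $A\subseteq G$, let $r_A(x)=|\{(a_1,a_2): a_1,a_2\in A,\ a_1+a_2=x\}|$ and $r'_A(x)=|\{(a_1,a_2): a_1,a_2\in A,\ a_1\ne a_2,\ a_1+a_2=x\}|$ (ordered pairs). $A$ is a $2$-Sidon set if $r_A(x)\le 2$ for all $x\in G$, and a weak $2$-Sidon set if $r'_A(x)\le 2$ for all $x\in G$. -}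

module Defs where

open import Data.Nat using (ℕ; _+_; _*_; _%_; _<_; _≡ᵇ_; NonZero)
open import Data.Nat.Properties using () renaming (_≟_ to _≟ℕ_)
open import Data.Bool using (if_then_else_)
open import Data.Fin using (Fin; toℕ; inject₁; fromℕ)
open import Data.Fin.Properties using () renaming (_≟_ to _≟F_)
open import Data.Fin.Subset using (Subset; _∈_; _∉_)
open import Data.Fin.Subset.Properties using (_∈?_)
open import Data.List using (List; length; filter; cartesianProduct; allFin)
open import Data.Product using (_×_; _,_; proj₁; proj₂)
open import Data.Vec using (tabulate; lookup)
open import Relation.Binary.PropositionalEquality using (_≡_)
open import Relation.Nullary using (¬_)
open import Relation.Nullary.Decidable using (_×-dec_; ¬?)

colour : (ℓ : ℕ) → .{{NonZero ℓ}} → ℕ → ℕ → ℕ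
colour ℓ i j = if j ≡ᵇ ℓ then (2 * i) % ℓ else (i + j) % ℓ

Rainbow : (ℓ : ℕ) → .{{NonZero ℓ}} → Subset (ℕ.suc ℓ) → Set
Rainbow ℓ S = ∀ (i j i' j' : Fin (ℕ.suc ℓ)) →
  i ∈ S → j ∈ S → i' ∈ S → j' ∈ S →
  toℕ i < toℕ j → toℕ i' < toℕ j' →
  colour ℓ (toℕ i) (toℕ j) ≡ colour ℓ (toℕ i') (toℕ j') →
  (i ≡ i') × (j ≡ j')

r : (ℓ : ℕ) → .{{NonZero ℓ}} → Subset ℓ → Fin ℓ → ℕ
r ℓ A x = length (filter
  (λ p → (proj₁ p ∈? A) ×-dec ((proj₂ p ∈? A) ×-dec
         (((toℕ (proj₁ p) + toℕ (proj₂ p)) % ℓ) ≟ℕ toℕ x)))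
  (cartesianProduct (allFin ℓ) (allFin ℓ)))

r' : (ℓ : ℕ) → .{{NonZero ℓ}} → Subset ℓ → Fin ℓ → ℕ
r' ℓ A x = length (filter
  (λ p → ¬? (proj₁ p ≟F proj₂ p) ×-dec ((proj₁ p ∈? A) ×-dec ((proj₂ p ∈? A) ×-dec
         (((toℕ (proj₁ p) + toℕ (proj₂ p)) % ℓ) ≟ℕ toℕ x))))
  (cartesianProduct (allFin ℓ) (allFin ℓ)))

TwoSidon : (ℓ : ℕ) → .{{NonZero ℓ}} → Subset ℓ → Set
TwoSidon ℓ A = ∀ x → r ℓ A x Data.Nat.≤ 2

WeakTwoSidon : (ℓ : ℕ) → .{{NonZero ℓ}} → Subset ℓ → Set
WeakTwoSidon ℓ A = ∀ x → r' ℓ A x Data.Nat.≤ 2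

-- The part of S ⊆ {0,…,ℓ} lying in {0,…,ℓ-1}, viewed as a subset of Z_ℓ.
-- (This equals S \ {ℓ}, and equals S when ℓ ∉ S.)
restrict : (ℓ : ℕ) → Subset (ℕ.suc ℓ) → Subset ℓ
restrict ℓ S = tabulate (λ a → lookup S (inject₁ a))

-- A pair {a, b} ⊆ A is encoded as an edge of K_{ℓ+1} inside S: the edge ab when
-- a ≠ b, and the edge aℓ when a = b (this one needs ℓ ∈ S).  Either way its colour is
-- a + b mod ℓ, so two pairs with the same sum are encoded by edges of the same
-- colour; since S is rainbow the edges coincide, hence so do the pairs up to order.  The ordered
-- pairs (a₁, a₂) counted by r_A(x) (resp. r'_A(x)) therefore all lie in {p, swap p}
-- for any one of them p, and there are at most two.
module Submission where

open import Defs
open import Data.Bool using (true; false; T)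
open import Data.Bool.Properties using (T-≡)
open import Data.Empty using (⊥-elim)
open import Data.Fin as Fin using (Fin; toℕ; inject₁; fromℕ)
open import Data.Fin.Properties
  using (toℕ-inject₁; toℕ-fromℕ; toℕ<n; toℕ-injective; inject₁-injective; fromℕ≢inject₁)
open import Data.Fin.Subset using (Subset; _∈_; _∉_)
open import Data.List using (List; []; _∷_; length; filter; cartesianProduct; allFin)
open import Data.List.Membership.Propositional using () renaming (_∈_ to _∈ₗ_)
open import Data.List.Membership.Propositional.Properties using (∈-filter⁻)
open import Data.List.Relation.Unary.AllPairs using (_∷_)
open import Data.List.Relation.Unary.All using (_∷_)
open import Data.List.Relation.Unary.Any using (here; there)
open import Data.List.Relation.Unary.Unique.Propositional using (Unique)
import Data.List.Relation.Unary.Unique.Propositional.Properties as Unique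
open import Data.Nat using (ℕ; suc; _+_; _%_; _<_; _≤_; _≡ᵇ_; z≤n; s≤s; NonZero)
open import Data.Nat.Properties using (<-cmp; <⇒≢; +-comm; +-identityʳ; ≡ᵇ⇒≡; ≡⇒≡ᵇ)
open import Data.Product using (_×_; _,_; proj₁; proj₂; swap)
open import Data.Sum using (_⊎_; inj₁; inj₂)
open import Data.Vec using (lookup)
open import Data.Vec.Properties using (lookup∘tabulate; []=⇒lookup; lookup⇒[]=)
open import Function.Bundles using (Equivalence)
open import Relation.Binary.Definitions using (tri<; tri≈; tri>)
open import Relation.Binary.PropositionalEquality
  using (_≡_; _≢_; refl; sym; trans; cong; cong₂; subst; subst₂)
open import Relation.Nullary using (yes; no)
open import Relation.Unary using (Pred; Decidable)
open import Level using (0ℓ)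

unique-length≤2 : {A : Set} (f : A → A) (xs : List A) → Unique xs →
  (∀ {p q} → p ∈ₗ xs → q ∈ₗ xs → q ≡ p ⊎ q ≡ f p) → length xs ≤ 2
unique-length≤2 f []              _ _ = z≤n
unique-length≤2 f (_ ∷ [])        _ _ = s≤s z≤n
unique-length≤2 f (_ ∷ _ ∷ [])    _ _ = s≤s (s≤s z≤n)
unique-length≤2 f (a ∷ b ∷ c ∷ _) ((a≢b ∷ a≢c ∷ _) ∷ (b≢c ∷ _) ∷ _) within
  with within (here refl) (there (here refl)) | within (here refl) (there (there (here refl)))
... | inj₁ b≡a | _        = ⊥-elim (a≢b (sym b≡a))
... | inj₂ _   | inj₁ c≡a = ⊥-elim (a≢c (sym c≡a))
... | inj₂ b≡fa | inj₂ c≡fa = ⊥-elim (b≢c (trans b≡fa (sym c≡fa)))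

filter-length≤2 : {A : Set} {P : Pred A 0ℓ} (P? : Decidable P) (f : A → A) (xs : List A) →
  Unique xs → (∀ {p q} → P p → P q → q ≡ p ⊎ q ≡ f p) → length (filter P? xs) ≤ 2
filter-length≤2 P? f xs unique within =
  unique-length≤2 f (filter P? xs) (Unique.filter⁺ P? unique) λ p∈ q∈ →
    within (proj₂ (∈-filter⁻ P? {xs = xs} p∈)) (proj₂ (∈-filter⁻ P? {xs = xs} q∈))

module _ (ℓ : ℕ) .{{_ : NonZero ℓ}} where

  colour-below : ∀ i {j} → j < ℓ → colour ℓ i j ≡ (i + j) % ℓ
  colour-below i {j} j<ℓ with j ≡ᵇ ℓ in eq
  ... | false = refl
  ... | true  = ⊥-elim (<⇒≢ j<ℓ (≡ᵇ⇒≡ j ℓ (subst T (sym eq) _)))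

  colour-top : ∀ i → colour ℓ i ℓ ≡ (i + i) % ℓ
  colour-top i rewrite Equivalence.to T-≡ (≡⇒≡ᵇ ℓ ℓ refl) =
    cong (λ k → (i + k) % ℓ) (+-identityʳ i)

  data Encodes (a b : Fin ℓ) (i j : Fin (suc ℓ)) : Set where
    forward  : i ≡ inject₁ a → j ≡ inject₁ b → Encodes a b i j
    backward : i ≡ inject₁ b → j ≡ inject₁ a → Encodes a b i j
    diagonal : a ≡ b → i ≡ inject₁ a → j ≡ fromℕ ℓ → Encodes a b i j

  private
    inject₁-cancel : ∀ {i : Fin (suc ℓ)} {a b : Fin ℓ} → i ≡ inject₁ a → i ≡ inject₁ b → a ≡ b
    inject₁-cancel i≡a i≡b = inject₁-injective (trans (sym i≡a) i≡b)

    top≢inject₁ : ∀ {a : Fin ℓ} → fromℕ ℓ ≢ inject₁ a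
    top≢inject₁ {a} = fromℕ≢inject₁ {i = a}

  encodes-unique : ∀ {a b c d i j} → Encodes a b i j → Encodes c d i j →
    (c , d) ≡ (a , b) ⊎ (c , d) ≡ (b , a)
  encodes-unique (forward i≡a j≡b) (forward i≡c j≡d) =
    inj₁ (cong₂ _,_ (inject₁-cancel i≡c i≡a) (inject₁-cancel j≡d j≡b))
  encodes-unique (forward i≡a j≡b) (backward i≡d j≡c) =
    inj₂ (cong₂ _,_ (inject₁-cancel j≡c j≡b) (inject₁-cancel i≡d i≡a))
  encodes-unique (backward i≡b j≡a) (forward i≡c j≡d) =
    inj₂ (cong₂ _,_ (inject₁-cancel i≡c i≡b) (inject₁-cancel j≡d j≡a))
  encodes-unique (backward i≡b j≡a) (backward i≡d j≡c) =
    inj₁ (cong₂ _,_ (inject₁-cancel j≡c j≡a) (inject₁-cancel i≡d i≡b))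
  encodes-unique (diagonal refl i≡a _) (diagonal refl i≡c _) = inj₁ (cong₂ _,_ c≡a c≡a)
    where c≡a = inject₁-cancel i≡c i≡a
  encodes-unique (forward _ j≡b)  (diagonal _ _ j≡ℓ) = ⊥-elim (top≢inject₁ (trans (sym j≡ℓ) j≡b))
  encodes-unique (backward _ j≡a) (diagonal _ _ j≡ℓ) = ⊥-elim (top≢inject₁ (trans (sym j≡ℓ) j≡a))
  encodes-unique (diagonal _ _ j≡ℓ) (forward _ j≡d)  = ⊥-elim (top≢inject₁ (trans (sym j≡ℓ) j≡d))
  encodes-unique (diagonal _ _ j≡ℓ) (backward _ j≡c) = ⊥-elim (top≢inject₁ (trans (sym j≡ℓ) j≡c))

∈-restrict⁻ : ∀ {ℓ} {S : Subset (suc ℓ)} {a : Fin ℓ} → a ∈ restrict ℓ S → inject₁ a ∈ S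
∈-restrict⁻ {ℓ} {S} {a} a∈ = lookup⇒[]= (inject₁ a) S
  (trans (sym (lookup∘tabulate (λ b → lookup S (inject₁ b)) a)) ([]=⇒lookup a∈))

pairs-unique : ∀ n → Unique (cartesianProduct (allFin n) (allFin n))
pairs-unique n = Unique.cartesianProduct⁺ (Unique.allFin⁺ n) (Unique.allFin⁺ n)

module _ (ℓ : ℕ) .{{_ : NonZero ℓ}} (S : Subset (suc ℓ)) (rainbow : Rainbow ℓ S) where

  private
    A : Subset ℓ
    A = restrict ℓ S

  SumsTo : Fin ℓ → Fin ℓ × Fin ℓ → Set
  SumsTo x (a₁ , a₂) = a₁ ∈ A × a₂ ∈ A × (toℕ a₁ + toℕ a₂) % ℓ ≡ toℕ x

  record SumEdge (a b : Fin ℓ) : Set where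
    field
      {i j}   : Fin (suc ℓ)
      i∈S     : i ∈ S
      j∈S     : j ∈ S
      i<j     : toℕ i < toℕ j
      colour≡ : colour ℓ (toℕ i) (toℕ j) ≡ (toℕ a + toℕ b) % ℓ
      encodes : Encodes ℓ a b i j

  sumEdge-swap : ∀ {a b} → SumEdge a b → SumEdge b a
  sumEdge-swap {a} {b} e = record
    { i∈S = i∈S ; j∈S = j∈S ; i<j = i<j
    ; colour≡ = trans colour≡ (cong (_% ℓ) (+-comm (toℕ a) (toℕ b)))
    ; encodes = flip encodes
    }
    where
      open SumEdge e
      flip : ∀ {i j} → Encodes ℓ a b i j → Encodes ℓ b a i j
      flip (forward i≡a j≡b)         = backward i≡a j≡b
      flip (backward i≡b j≡a)        = forward i≡b j≡a
      flip (diagonal refl i≡a j≡ℓ)   = diagonal refl i≡a j≡ℓ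

  sumEdge-unique : ∀ {a b c d} → SumEdge a b → SumEdge c d →
    (toℕ a + toℕ b) % ℓ ≡ (toℕ c + toℕ d) % ℓ → (c , d) ≡ (a , b) ⊎ (c , d) ≡ (b , a)
  sumEdge-unique e e' sums≡ =
    encodes-unique ℓ (encodes e)
      (subst₂ (Encodes ℓ _ _) (sym (proj₁ same-edge)) (sym (proj₂ same-edge)) (encodes e'))
    where
      open SumEdge
      same-edge : (i e ≡ i e') × (j e ≡ j e')
      same-edge = rainbow (i e) (j e) (i e') (j e') (i∈S e) (j∈S e) (i∈S e') (j∈S e')
        (i<j e) (i<j e') (trans (colour≡ e) (trans sums≡ (sym (colour≡ e'))))

  orderedEdge : ∀ {a b} → toℕ a < toℕ b → a ∈ A → b ∈ A → SumEdge a b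
  orderedEdge {a} {b} a<b a∈A b∈A = record
    { i∈S = ∈-restrict⁻ a∈A ; j∈S = ∈-restrict⁻ b∈A
    ; i<j = subst₂ _<_ (sym (toℕ-inject₁ a)) (sym (toℕ-inject₁ b)) a<b
    ; colour≡ = colour≡
    ; encodes = forward refl refl
    }
    where
      colour≡ : colour ℓ (toℕ (inject₁ a)) (toℕ (inject₁ b)) ≡ (toℕ a + toℕ b) % ℓ
      colour≡ rewrite toℕ-inject₁ a | toℕ-inject₁ b = colour-below ℓ (toℕ a) (toℕ<n b)

  offDiagonalEdge : ∀ {a b} → a ≢ b → a ∈ A → b ∈ A → SumEdge a b
  offDiagonalEdge {a} {b} a≢b a∈A b∈A with <-cmp (toℕ a) (toℕ b)
  ... | tri< a<b _ _ = orderedEdge a<b a∈A b∈A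
  ... | tri≈ _ a≡b _ = ⊥-elim (a≢b (toℕ-injective a≡b))
  ... | tri> _ _ b<a = sumEdge-swap (orderedEdge b<a b∈A a∈A)

  diagonalEdge : ∀ {a} → a ∈ A → fromℕ ℓ ∈ S → SumEdge a a
  diagonalEdge {a} a∈A ℓ∈S = record
    { i∈S = ∈-restrict⁻ a∈A ; j∈S = ℓ∈S
    ; i<j = subst₂ _<_ (sym (toℕ-inject₁ a)) (sym (toℕ-fromℕ ℓ)) (toℕ<n a)
    ; colour≡ = colour≡
    ; encodes = diagonal refl refl refl
    }
    where
      colour≡ : colour ℓ (toℕ (inject₁ a)) (toℕ (fromℕ ℓ)) ≡ (toℕ a + toℕ a) % ℓ
      colour≡ rewrite toℕ-inject₁ a | toℕ-fromℕ ℓ = colour-top ℓ (toℕ a)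

  restrict-twoSidon : fromℕ ℓ ∈ S → TwoSidon ℓ A
  restrict-twoSidon ℓ∈S x = filter-length≤2 _ swap _ (pairs-unique ℓ) within
    where
      sumEdge : ∀ {a b} → a ∈ A → b ∈ A → SumEdge a b
      sumEdge {a} {b} a∈A b∈A with a Fin.≟ b
      ... | yes refl = diagonalEdge a∈A ℓ∈S
      ... | no a≢b   = offDiagonalEdge a≢b a∈A b∈A

      within : ∀ {p q} → SumsTo x p → SumsTo x q → q ≡ p ⊎ q ≡ swap p
      within (a₁∈A , a₂∈A , sum≡x) (c₁∈A , c₂∈A , sum≡x′) =
        sumEdge-unique (sumEdge a₁∈A a₂∈A) (sumEdge c₁∈A c₂∈A) (trans sum≡x (sym sum≡x′))

  restrict-weakTwoSidon : WeakTwoSidon ℓ A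
  restrict-weakTwoSidon x = filter-length≤2 _ swap _ (pairs-unique ℓ) within
    where
      within : ∀ {p q} → proj₁ p ≢ proj₂ p × SumsTo x p → proj₁ q ≢ proj₂ q × SumsTo x q →
        q ≡ p ⊎ q ≡ swap p
      within (a₁≢a₂ , a₁∈A , a₂∈A , sum≡x) (c₁≢c₂ , c₁∈A , c₂∈A , sum≡x′) =
        sumEdge-unique (offDiagonalEdge a₁≢a₂ a₁∈A a₂∈A) (offDiagonalEdge c₁≢c₂ c₁∈A c₂∈A)
          (trans sum≡x (sym sum≡x′))

lemma3 : (ℓ : ℕ) → .{{_ : NonZero ℓ}} → 3 ≤ ℓ → ℓ % 2 ≡ 1 →
    (S : Subset (ℕ.suc ℓ)) → Rainbow ℓ S →
    (fromℕ ℓ ∈ S → TwoSidon ℓ (restrict ℓ S)) ×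
    (fromℕ ℓ ∉ S → WeakTwoSidon ℓ (restrict ℓ S))
lemma3 ℓ _ _ S rainbow = restrict-twoSidon ℓ S rainbow , λ _ → restrict-weakTwoSidon ℓ S rainbow
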